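{- Let $\sigma$ be a 2-structure and let $X\subsetneq V(\sigma)$ be such that $\sigma[X]$ is prime. Suppose that Statement (S5) holds, i.e. there is no $5$-element subset $Y\subseteq\overline{X}$ such that $\sigma[X\cup Y]$ is prime. Then no connected component $C$ of $\Gamma_{(\sigma,\overline{X})}$ has an induced subgraph isomorphic to the path $P_5$ on $5$ vertices.
   Context: A 2-structure $\sigma$ consists of a vertex set $V(\sigma)$ and an equivalence relation $\equiv_\sigma$ on the set of ordered pairs $(u,v)$ of distinct elements of $V(\sigma)$. For $W\subseteq V(\sigma)$, $\sigma[W]$ is the 2-structure on $W$ with the restricted equivalence relation. $\overline{X}=V(\sigma)\setminus X$. A subset $M\subseteq V(\sigma)$ is a module of $\sigma$ if for all $x,y\in M$ and $v\in V(\sigma)\setminus M$, $(x,v)\equiv_\sigma(y,v)$ and $(v,x)\equiv_\sigma(v,y)$; $\emptyset$, $V(\sigma)$ and singletons are trivial modules. $\sigma$ is prime if $|V(\sigma)|\geq 3$ and all its modules are trivial. For $X\subsetneq V(\sigma)$ with $\sigma[X]$ prime, the outside graph $\Gamma_{(\sigma,\overline{X})}$ is the graph with vertex set $\overline{X}$ whose edges are the 2-element subsets $Y\subseteq\overline{X}$ such that $\sigma[X\cup Y]$ is prime. -}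

module Defs where

open import Level using (0ℓ)
open import Data.Nat using (ℕ; _≤_; _+_)
open import Relation.Nullary using (¬_)
open import Data.Fin using (Fin; toℕ)
open import Data.Fin.Subset using (Subset; _∈_; _∉_; _⊆_; _⊂_; ⊥; ⊤; ⁅_⁆; _∪_; ∁; ∣_∣)
open import Data.Product using (Σ; ∃; ∃-syntax; _×_; _,_)
open import Data.Sum using (_⊎_)
open import Relation.Binary using (Rel; IsEquivalence)
open import Relation.Binary.PropositionalEquality using (_≡_; _≢_)
open import Relation.Binary.Construct.Closure.ReflexiveTransitive using (Star)
open import Function.Bundles using (_⇔_)
open import Function.Definitions using (Injective)

-- The equivalence relation is given on all ordered pairs of Fin n × Fin n,
-- but it is only ever consulted on pairs of distinct vertices
-- (any equivalence on distinct pairs extends to such a relation).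
record TwoStructure (n : ℕ) : Set₁ where
  field
    _≈_           : Rel (Fin n × Fin n) 0ℓ
    isEquivalence : IsEquivalence _≈_

open TwoStructure public

module _ {n : ℕ} (σ : TwoStructure n) where

  IsModule : Subset n → Subset n → Set
  IsModule W M =
    M ⊆ W ×
    (∀ {x y v} → x ∈ M → y ∈ M → v ∈ W → v ∉ M →
       _≈_ σ (x , v) (y , v) × _≈_ σ (v , x) (v , y))

  IsTrivialModule : Subset n → Subset n → Set
  IsTrivialModule W M = M ≡ ⊥ ⊎ M ≡ W ⊎ ∃[ x ] M ≡ ⁅ x ⁆

  IsPrime : Subset n → Set
  IsPrime W = 3 ≤ ∣ W ∣ × (∀ M → IsModule W M → IsTrivialModule W M)

  OutsideEdge : Subset n → Fin n → Fin n → Set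
  OutsideEdge X u v = u ∉ X × v ∉ X × u ≢ v × IsPrime (X ∪ (⁅ u ⁆ ∪ ⁅ v ⁆))

  InComponent : Subset n → Fin n → Fin n → Set
  InComponent X c v = Star (OutsideEdge X) c v

  S5 : Subset n → Set
  S5 X = ¬ (Σ (Subset n) λ Y → Y ⊆ ∁ X × ∣ Y ∣ ≡ 5 × IsPrime (X ∪ Y))

P5Adj : Fin 5 → Fin 5 → Set
P5Adj i j = toℕ i + 1 ≡ toℕ j ⊎ toℕ j + 1 ≡ toℕ i

module _ {n : ℕ} (σ : TwoStructure n) where

  ComponentHasInducedP5 : Subset n → Fin n → Set
  ComponentHasInducedP5 X c =
    Σ (Fin 5 → Fin n) λ f →
      Injective _≡_ _≡_ f ×
      (∀ i → InComponent σ X c (f i)) ×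
      (∀ i j → OutsideEdge σ X (f i) (f j) ⇔ P5Adj i j)

-- Put Y := f({0,…,4}) for an induced P5 f of the outside graph Γ; we show that σ[X ∪ Y] is
-- prime, contradicting (S5). Let M be a module of σ[X ∪ Y] containing two distinct points.
-- Whenever M meets some prime σ[X ∪ {u, z}] (an edge uz of Γ) in two points it swallows it,
-- so M ⊇ X as soon as M contains two points of X, a point of X and a point of Y (use an edge
-- at the latter), or the two ends of an edge. The remaining case is two non-adjacent
-- u, w ∈ M ∩ Y, M ∩ X = ∅; in P5 some z ∈ Y is adjacent to exactly one of them, say u, and
-- z ∉ M (else uz is an edge inside M). Then u and w are twins over X ∪ {z}, so swapping
-- them carries the prime σ[X ∪ {u, z}] onto σ[X ∪ {w, z}], making wz an edge: a
-- contradiction. Once X ⊆ M, every v ∈ Y joins M along an edge at v.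
module Submission where

open import Defs
open import Level using (Level)
open import Data.Nat using (ℕ; zero; suc; _≤_)
import Data.Nat as ℕ
open import Data.Nat.Properties using (≤-trans; n≤1+n)
open import Data.Fin using (Fin; zero; suc; toℕ)
open import Data.Fin.Properties using (_≟_; all?; any?)
open import Data.Fin.Permutation.Components using (transpose; transpose-inverse)
open import Data.Fin.Subset
open import Data.Fin.Subset.Properties
open import Data.Vec using ([]; _∷_; here; there)
open import Data.List using (List; []; _∷_; length; tabulate)
open import Data.List.Properties using (length-tabulate)
import Data.List.Membership.Propositional as List
open import Data.List.Membership.Propositional.Properties using (∈-tabulate⁺; ∈-tabulate⁻)
open import Data.List.Relation.Unary.Any using (here; there)
open import Data.List.Relation.Unary.All.Properties using (All¬⇒¬Any)
open import Data.List.Relation.Unary.AllPairs using ([]; _∷_)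
open import Data.List.Relation.Unary.Unique.Propositional using (Unique)
import Data.List.Relation.Unary.Unique.Propositional.Properties as Unique
open import Data.Product using (∃-syntax; ∃₂; _×_; _,_; proj₁; proj₂)
open import Data.Sum using (_⊎_; inj₁; inj₂)
open import Function using (_∘_)
open import Function.Bundles using (_⇔_; Equivalence)
open import Function.Definitions using (Injective)
open import Relation.Nullary using (¬_; Dec; yes; no; does; ¬?; contradiction)
open import Relation.Nullary.Decidable using (_×-dec_; _⊎-dec_; from-yes; dec-true; dec-false)
open import Relation.Unary using (Pred; Decidable)
open import Relation.Binary using (IsEquivalence)
open import Relation.Binary.PropositionalEquality using (_≡_; _≢_; refl; sym; trans; cong; subst)

private
  variable
    ℓ : Level
    n : ℕ
    a b c u v w x z : Fin n
    p X : Subset n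

select : {P : Pred (Fin n) ℓ} → Decidable P → Subset n
select {zero}  P? = []
select {suc n} P? = does (P? zero) ∷ select (P? ∘ suc)

∈-select⁺ : {P : Pred (Fin n) ℓ} (P? : Decidable P) → P x → x ∈ select P?
∈-select⁺ {x = zero} P? px with P? zero
... | yes _ = here
... | no ¬px = contradiction px ¬px
∈-select⁺ {x = suc x} P? px = there (∈-select⁺ (P? ∘ suc) px)

∈-select⁻ : {P : Pred (Fin n) ℓ} (P? : Decidable P) → x ∈ select P? → P x
∈-select⁻ {x = zero} P? x∈ with P? zero | x∈
... | yes px | _ = px
∈-select⁻ {x = suc x} P? (there x∈) = ∈-select⁻ (P? ∘ suc) x∈

∣⁅x⁆∪p∣≡1+∣p∣ : x ∉ p → ∣ ⁅ x ⁆ ∪ p ∣ ≡ suc ∣ p ∣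
∣⁅x⁆∪p∣≡1+∣p∣ {x = zero}  {inside  ∷ p} x∉ = contradiction here x∉
∣⁅x⁆∪p∣≡1+∣p∣ {x = zero}  {outside ∷ p} x∉ = cong (suc ∘ ∣_∣) (∪-identityˡ p)
∣⁅x⁆∪p∣≡1+∣p∣ {x = suc x} {inside  ∷ p} x∉ = cong suc (∣⁅x⁆∪p∣≡1+∣p∣ (x∉ ∘ there))
∣⁅x⁆∪p∣≡1+∣p∣ {x = suc x} {outside ∷ p} x∉ = ∣⁅x⁆∪p∣≡1+∣p∣ (x∉ ∘ there)

empty-singleton-or-pair : (p : Subset n) →
  p ≡ ⊥ ⊎ (∃[ x ] p ≡ ⁅ x ⁆) ⊎ (∃₂ λ u w → u ∈ p × w ∈ p × u ≢ w)
empty-singleton-or-pair p with nonempty? p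
... | no ¬nonempty = inj₁ (Empty-unique ¬nonempty)
... | yes (x , x∈p) with any? (λ y → (y ∈? p) ×-dec ¬? (y ≟ x))
...   | yes (y , y∈p , y≢x) = inj₂ (inj₂ (y , x , y∈p , x∈p , y≢x))
...   | no ¬other = inj₂ (inj₁ (x , ⊆-antisym p⊆⁅x⁆ λ y∈ → subst (_∈ p) (sym (x∈⁅y⁆⇒x≡y x y∈)) x∈p))
  where
  p⊆⁅x⁆ : p ⊆ ⁅ x ⁆
  p⊆⁅x⁆ {y} y∈p with y ≟ x
  ... | yes refl = x∈⁅x⁆ x
  ... | no y≢x = contradiction (y , y∈p , y≢x) ¬other

pair-of-2≤∣p∣ : 2 ≤ ∣ p ∣ → ∃₂ λ u w → u ∈ p × w ∈ p × u ≢ w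
pair-of-2≤∣p∣ {n} {p} size with empty-singleton-or-pair p
... | inj₁ refl = contradiction (subst (2 ≤_) (∣⊥∣≡0 n) size) λ ()
... | inj₂ (inj₁ (x , refl)) = contradiction (subst (2 ≤_) (∣⁅x⁆∣≡1 x) size) λ { (ℕ.s≤s ()) }
... | inj₂ (inj₂ pair) = pair

fromList : List (Fin n) → Subset n
fromList []       = ⊥
fromList (x ∷ xs) = ⁅ x ⁆ ∪ fromList xs

∈-fromList⁺ : ∀ {xs} → x List.∈ xs → x ∈ fromList xs
∈-fromList⁺ {x = x} (here refl) = x∈p∪q⁺ (inj₁ (x∈⁅x⁆ x))
∈-fromList⁺ (there x∈xs) = x∈p∪q⁺ (inj₂ (∈-fromList⁺ x∈xs))

∈-fromList⁻ : ∀ xs → x ∈ fromList xs → x List.∈ xs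
∈-fromList⁻ []       x∈ = contradiction x∈ ∉⊥
∈-fromList⁻ (y ∷ xs) x∈ with x∈p∪q⁻ ⁅ y ⁆ (fromList xs) x∈
... | inj₁ x∈⁅y⁆ = here (x∈⁅y⁆⇒x≡y y x∈⁅y⁆)
... | inj₂ x∈xs = there (∈-fromList⁻ xs x∈xs)

∣fromList∣≡length : ∀ {xs : List (Fin n)} → Unique xs → ∣ fromList xs ∣ ≡ length xs
∣fromList∣≡length {n} {[]} [] = ∣⊥∣≡0 n
∣fromList∣≡length {xs = x ∷ xs} (x∉xs ∷ unique) =
  trans (∣⁅x⁆∪p∣≡1+∣p∣ (All¬⇒¬Any x∉xs ∘ ∈-fromList⁻ xs)) (cong suc (∣fromList∣≡length unique))

image : ∀ {m} → (Fin m → Fin n) → Subset n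
image f = fromList (tabulate f)

∈-image⁺ : ∀ {m} (f : Fin m → Fin n) i → f i ∈ image f
∈-image⁺ f i = ∈-fromList⁺ (∈-tabulate⁺ i)

∈-image⁻ : ∀ {m} (f : Fin m → Fin n) → v ∈ image f → ∃[ i ] v ≡ f i
∈-image⁻ f = ∈-tabulate⁻ ∘ ∈-fromList⁻ (tabulate f)

∣image∣≡ : ∀ {m} {f : Fin m → Fin n} → Injective _≡_ _≡_ f → ∣ image f ∣ ≡ m
∣image∣≡ {f = f} f-inj = trans (∣fromList∣≡length (Unique.tabulate⁺ f-inj)) (length-tabulate f)

transpose-sends : (i j : Fin n) → transpose i j i ≡ j
transpose-sends i j rewrite dec-true (i ≟ i) refl = refl

transpose-fixes : ∀ {i j k : Fin n} → k ≢ i → k ≢ j → transpose i j k ≡ k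
transpose-fixes {i = i} {j} {k} k≢i k≢j rewrite dec-false (k ≟ i) k≢i | dec-false (k ≟ j) k≢j = refl

_∪⁅_,_⁆ : Subset n → Fin n → Fin n → Subset n
X ∪⁅ a , c ⁆ = X ∪ (⁅ a ⁆ ∪ ⁅ c ⁆)

∈-∪⁅,⁆⁻ : v ∈ X ∪⁅ a , c ⁆ → v ∈ X ⊎ v ≡ a ⊎ v ≡ c
∈-∪⁅,⁆⁻ {X = X} {a} {c} v∈ with x∈p∪q⁻ X _ v∈
... | inj₁ v∈X = inj₁ v∈X
... | inj₂ v∈ac with x∈p∪q⁻ ⁅ a ⁆ ⁅ c ⁆ v∈ac
...   | inj₁ v∈a = inj₂ (inj₁ (x∈⁅y⁆⇒x≡y a v∈a))
...   | inj₂ v∈c = inj₂ (inj₂ (x∈⁅y⁆⇒x≡y c v∈c))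

∈-∪⁅,⁆ˡ : v ∈ X → v ∈ X ∪⁅ a , c ⁆
∈-∪⁅,⁆ˡ v∈X = x∈p∪q⁺ (inj₁ v∈X)

∈-∪⁅,⁆₁ : a ∈ X ∪⁅ a , c ⁆
∈-∪⁅,⁆₁ {a = a} = x∈p∪q⁺ (inj₂ (x∈p∪q⁺ (inj₁ (x∈⁅x⁆ a))))

∈-∪⁅,⁆₂ : c ∈ X ∪⁅ a , c ⁆
∈-∪⁅,⁆₂ {c = c} = x∈p∪q⁺ (inj₂ (x∈p∪q⁺ (inj₂ (x∈⁅x⁆ c))))

∉-∪⁅,⁆ : v ∉ X → v ≢ a → v ≢ c → v ∉ X ∪⁅ a , c ⁆
∉-∪⁅,⁆ v∉X v≢a v≢c v∈ with ∈-∪⁅,⁆⁻ v∈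
... | inj₁ v∈X = v∉X v∈X
... | inj₂ (inj₁ v≡a) = v≢a v≡a
... | inj₂ (inj₂ v≡c) = v≢c v≡c

transpose-∈ : a ∉ X → b ∉ X → a ≢ c → b ≢ c →
              v ∈ X ∪⁅ a , c ⁆ → transpose a b v ∈ X ∪⁅ b , c ⁆
transpose-∈ {a = a} {b = b} a∉X b∉X a≢c b≢c v∈ with ∈-∪⁅,⁆⁻ v∈
... | inj₁ v∈X = subst (_∈ _) (sym (transpose-fixes (λ { refl → a∉X v∈X }) λ { refl → b∉X v∈X }))
                       (∈-∪⁅,⁆ˡ v∈X)
... | inj₂ (inj₁ refl) = subst (_∈ _) (sym (transpose-sends a b)) ∈-∪⁅,⁆₁
... | inj₂ (inj₂ refl) = subst (_∈ _) (sym (transpose-fixes (a≢c ∘ sym) (b≢c ∘ sym))) ∈-∪⁅,⁆₂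

module _ (σ : TwoStructure n) where

  private
    _∼_ = _≈_ σ
    open IsEquivalence (isEquivalence σ) using () renaming (refl to ∼-refl; sym to ∼-sym; trans to ∼-trans)

  Indecomposable : Subset n → Set
  Indecomposable W = ∀ {M u w} → IsModule σ W M → u ∈ M → w ∈ M → u ≢ w → W ⊆ M

  isPrime⇒indecomposable : ∀ {W} → IsPrime σ W → Indecomposable W
  isPrime⇒indecomposable (_ , trivial) {M} mod u∈ w∈ u≢w with trivial M mod
  ... | inj₁ refl = contradiction u∈ ∉⊥
  ... | inj₂ (inj₁ refl) = λ v∈ → v∈
  ... | inj₂ (inj₂ (x , refl)) = contradiction (trans (x∈⁅y⁆⇒x≡y x u∈) (sym (x∈⁅y⁆⇒x≡y x w∈))) u≢w

  indecomposable⇒isPrime : ∀ {W} → 3 ≤ ∣ W ∣ → Indecomposable W → IsPrime σ W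
  indecomposable⇒isPrime {W} size indecomposable = size , trivial
    where
    trivial : ∀ M → IsModule σ W M → IsTrivialModule σ W M
    trivial M mod with empty-singleton-or-pair M
    ... | inj₁ M≡⊥ = inj₁ M≡⊥
    ... | inj₂ (inj₁ singleton) = inj₂ (inj₂ singleton)
    ... | inj₂ (inj₂ (u , w , u∈ , w∈ , u≢w)) =
      inj₂ (inj₁ (⊆-antisym (proj₁ mod) (indecomposable mod u∈ w∈ u≢w)))

  IsModule-∩ : ∀ {W M P} → IsModule σ W M → P ⊆ W → IsModule σ P (M ∩ P)
  IsModule-∩ {W} {M} {P} (_ , mod) P⊆W =
    p∩q⊆q M P , λ x∈ y∈ v∈P v∉ →
      mod (p∩q⊆p M P x∈) (p∩q⊆p M P y∈) (P⊆W v∈P) (λ v∈M → v∉ (x∈p∩q⁺ (v∈M , v∈P)))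

  indecomposable-⊆-module : ∀ {W M P} → Indecomposable P → P ⊆ W → IsModule σ W M →
    u ∈ P → w ∈ P → u ∈ M → w ∈ M → u ≢ w → P ⊆ M
  indecomposable-⊆-module {M = M} {P} indecomposable P⊆W mod u∈P w∈P u∈M w∈M u≢w =
    p∩q⊆p M P ∘ indecomposable (IsModule-∩ mod P⊆W) (x∈p∩q⁺ (u∈M , u∈P)) (x∈p∩q⁺ (w∈M , w∈P)) u≢w

  record Relabelling (A B : Subset n) : Set where
    field
      to from : Fin n → Fin n
      to-∈    : ∀ {v} → v ∈ A → to v ∈ B
      from-∈  : ∀ {v} → v ∈ B → from v ∈ A
      to∘from : ∀ {v} → v ∈ B → to (from v) ≡ v
      to-∼    : ∀ {x v} → x ∈ A → v ∈ A → x ≢ v → (x , v) ∼ (to x , to v)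

  indecomposable-relabel : ∀ {A B} → Relabelling A B → Indecomposable A → Indecomposable B
  indecomposable-relabel {A} {B} ρ indecomposable {M} (M⊆B , mod) u∈M w∈M u≢w v∈B =
    subst (_∈ M) (to∘from v∈B) (proj₂ (∈-select⁻ ∈D? (A⊆D (from-∈ v∈B))))
    where
    open Relabelling ρ
    ∈D? : Decidable (λ v → v ∈ A × to v ∈ M)
    ∈D? v = (v ∈? A) ×-dec (to v ∈? M)
    D = select ∈D?

    D-module : IsModule σ A D
    D-module = proj₁ ∘ ∈-select⁻ ∈D? , λ {x} {y} {v} x∈D y∈D v∈A v∉D →
      let (x∈A , tx∈M) = ∈-select⁻ ∈D? x∈D
          (y∈A , ty∈M) = ∈-select⁻ ∈D? y∈D
          x≢v : x ≢ v
          x≢v = λ { refl → v∉D x∈D }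
          y≢v : y ≢ v
          y≢v = λ { refl → v∉D y∈D }
          (out , into) = mod tx∈M ty∈M (to-∈ v∈A) (λ tv∈M → v∉D (∈-select⁺ ∈D? (v∈A , tv∈M)))
      in ∼-trans (to-∼ x∈A v∈A x≢v) (∼-trans out (∼-sym (to-∼ y∈A v∈A y≢v))) ,
         ∼-trans (to-∼ v∈A x∈A (x≢v ∘ sym)) (∼-trans into (∼-sym (to-∼ v∈A y∈A (y≢v ∘ sym))))

    pull-back : ∀ {v} → v ∈ M → from v ∈ D
    pull-back v∈M = ∈-select⁺ ∈D? (from-∈ (M⊆B v∈M) , subst (_∈ M) (sym (to∘from (M⊆B v∈M))) v∈M)

    A⊆D : A ⊆ D
    A⊆D = indecomposable D-module (pull-back u∈M) (pull-back w∈M)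
      λ e → u≢w (trans (sym (to∘from (M⊆B u∈M))) (trans (cong to e) (to∘from (M⊆B w∈M))))

  Twins : Subset n → Fin n → Fin n → Set
  Twins Z a b = ∀ {z} → z ∈ Z → (a , z) ∼ (b , z) × (z , a) ∼ (z , b)

  twins-relabelling : a ∉ X → b ∉ X → a ≢ b → a ≢ c → b ≢ c → Twins (X ∪ ⁅ c ⁆) a b →
                      Relabelling (X ∪⁅ a , c ⁆) (X ∪⁅ b , c ⁆)
  twins-relabelling {a = a} {X = X} {b} {c} a∉X b∉X a≢b a≢c b≢c twins = record
    { to      = transpose a b
    ; from    = transpose b a
    ; to-∈    = transpose-∈ a∉X b∉X a≢c b≢c
    ; from-∈  = transpose-∈ b∉X a∉X b≢c a≢c
    ; to∘from = λ _ → transpose-inverse a b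
    ; to-∼    = to-∼
    }
    where
    ∈X∪⁅c⁆ : v ∈ X ∪⁅ a , c ⁆ → v ≢ a → v ∈ X ∪ ⁅ c ⁆
    ∈X∪⁅c⁆ v∈ v≢a with ∈-∪⁅,⁆⁻ v∈
    ... | inj₁ v∈X = x∈p∪q⁺ (inj₁ v∈X)
    ... | inj₂ (inj₁ v≡a) = contradiction v≡a v≢a
    ... | inj₂ (inj₂ refl) = x∈p∪q⁺ (inj₂ (x∈⁅x⁆ c))

    fixed : v ∈ X ∪⁅ a , c ⁆ → v ≢ a → transpose a b v ≡ v
    fixed v∈ v≢a = transpose-fixes v≢a λ { refl → ∉-∪⁅,⁆ b∉X (a≢b ∘ sym) b≢c v∈ }

    to-∼ : ∀ {x v} → x ∈ X ∪⁅ a , c ⁆ → v ∈ X ∪⁅ a , c ⁆ → x ≢ v →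
           (x , v) ∼ (transpose a b x , transpose a b v)
    to-∼ {x} {v} x∈ v∈ x≢v = by-cases (x ≟ a) (v ≟ a)
      where
      by-cases : Dec (x ≡ a) → Dec (v ≡ a) → (x , v) ∼ (transpose a b x , transpose a b v)
      by-cases (yes refl) (yes refl) = contradiction refl x≢v
      by-cases (yes refl) (no v≢a) rewrite transpose-sends a b | fixed v∈ v≢a =
        proj₁ (twins (∈X∪⁅c⁆ v∈ v≢a))
      by-cases (no x≢a) (yes refl) rewrite transpose-sends a b | fixed x∈ x≢a =
        proj₂ (twins (∈X∪⁅c⁆ x∈ x≢a))
      by-cases (no x≢a) (no v≢a) rewrite fixed x∈ x≢a | fixed v∈ v≢a = ∼-refl

  edge-twins : 3 ≤ ∣ X ∣ → Twins (X ∪ ⁅ z ⁆) u w → w ∉ X → u ≢ w → w ≢ z →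
               OutsideEdge σ X u z → OutsideEdge σ X w z
  edge-twins {X = X} size twins w∉X u≢w w≢z (u∉X , z∉X , u≢z , prime) =
    w∉X , z∉X , w≢z ,
    indecomposable⇒isPrime (≤-trans size (∣p∣≤∣p∪q∣ X _))
      (indecomposable-relabel (twins-relabelling u∉X w∉X u≢w u≢z w≢z twins)
        (isPrime⇒indecomposable prime))

module _ (σ : TwoStructure n) (X : Subset n) where

  private
    Edge = OutsideEdge σ X

  NoIsolatedVertex : Subset n → Set
  NoIsolatedVertex Y = ∀ {u} → u ∈ Y → ∃[ z ] z ∈ Y × Edge u z

  Distinguishes : Fin n → Fin n → Fin n → Set
  Distinguishes z u w = Edge u z × ¬ Edge w z

  AdjacentOrDistinguished : Subset n → Set
  AdjacentOrDistinguished Y = ∀ {u w} → u ∈ Y → w ∈ Y → u ≢ w →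
    Edge u w ⊎ ∃[ z ] z ∈ Y × (Distinguishes z u w ⊎ Distinguishes z w u)

  module _ (X-prime : IsPrime σ X) {Y : Subset n} (Y⊆∁X : Y ⊆ ∁ X)
           (no-isolated : NoIsolatedVertex Y) (adjacent-or-distinguished : AdjacentOrDistinguished Y)
           where

    private
      W = X ∪ Y

      ∈Y⇒∉X : v ∈ Y → v ∉ X
      ∈Y⇒∉X = x∈∁p⇒x∉p ∘ Y⊆∁X

      ∪⁅,⁆⊆W : u ∈ Y → z ∈ Y → X ∪⁅ u , z ⁆ ⊆ W
      ∪⁅,⁆⊆W u∈Y z∈Y v∈ with ∈-∪⁅,⁆⁻ v∈
      ... | inj₁ v∈X = x∈p∪q⁺ (inj₁ v∈X)
      ... | inj₂ (inj₁ refl) = x∈p∪q⁺ (inj₂ u∈Y)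
      ... | inj₂ (inj₂ refl) = x∈p∪q⁺ (inj₂ z∈Y)

      edge-ends-distinct : Edge u z → u ≢ z
      edge-ends-distinct (_ , _ , u≢z , _) = u≢z

    module _ {M : Subset n} (M-module : IsModule σ W M) where

      private
        edge-⊆-module : u ∈ Y → z ∈ Y → Edge u z →
          x ∈ X ∪⁅ u , z ⁆ → v ∈ X ∪⁅ u , z ⁆ → x ∈ M → v ∈ M → x ≢ v → X ∪⁅ u , z ⁆ ⊆ M
        edge-⊆-module u∈Y z∈Y (_ , _ , _ , prime) =
          indecomposable-⊆-module σ (isPrime⇒indecomposable σ prime) (∪⁅,⁆⊆W u∈Y z∈Y) M-module

        X⊆M-via-edge : u ∈ Y → z ∈ Y → Edge u z →
          x ∈ X ∪⁅ u , z ⁆ → v ∈ X ∪⁅ u , z ⁆ → x ∈ M → v ∈ M → x ≢ v → X ⊆ M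
        X⊆M-via-edge u∈Y z∈Y uz x∈ v∈ x∈M v∈M x≢v =
          edge-⊆-module u∈Y z∈Y uz x∈ v∈ x∈M v∈M x≢v ∘ ∈-∪⁅,⁆ˡ

        X⊆M-via-X∩M : x ∈ X → x ∈ M → v ∈ Y → v ∈ M → X ⊆ M
        X⊆M-via-X∩M x∈X x∈M v∈Y v∈M =
          let (z , z∈Y , vz) = no-isolated v∈Y
          in X⊆M-via-edge v∈Y z∈Y vz (∈-∪⁅,⁆ˡ x∈X) ∈-∪⁅,⁆₁ x∈M v∈M λ { refl → ∈Y⇒∉X v∈Y x∈X }

        X⊆M-distinguished : u ∈ Y → w ∈ Y → z ∈ Y → u ∈ M → w ∈ M → u ≢ w →
                            Distinguishes z u w → X ⊆ M
        X⊆M-distinguished {u} {w} {z} u∈Y w∈Y z∈Y u∈M w∈M u≢w (uz , ¬wz) with z ∈? M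
        ... | yes z∈M = X⊆M-via-edge u∈Y z∈Y uz ∈-∪⁅,⁆₁ ∈-∪⁅,⁆₂ u∈M z∈M (edge-ends-distinct uz)
        ... | no z∉M with nonempty? (X ∩ M)
        ...   | yes (x , x∈X∩M) = X⊆M-via-X∩M (p∩q⊆p X M x∈X∩M) (p∩q⊆q X M x∈X∩M) u∈Y u∈M
        ...   | no X∩M-empty =
          contradiction (edge-twins σ (proj₁ X-prime) twins (∈Y⇒∉X w∈Y) u≢w w≢z uz) ¬wz
          where
          w≢z : w ≢ z
          w≢z refl = z∉M w∈M
          twins : Twins σ (X ∪ ⁅ z ⁆) u w
          twins v∈ with x∈p∪q⁻ X ⁅ z ⁆ v∈
          ... | inj₁ v∈X = proj₂ M-module u∈M w∈M (x∈p∪q⁺ (inj₁ v∈X))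
                                 λ v∈M → X∩M-empty (_ , x∈p∩q⁺ (v∈X , v∈M))
          ... | inj₂ v∈⁅z⁆ rewrite x∈⁅y⁆⇒x≡y z v∈⁅z⁆ = proj₂ M-module u∈M w∈M (x∈p∪q⁺ (inj₂ z∈Y)) z∉M

      X⊆M : u ∈ M → w ∈ M → u ≢ w → X ⊆ M
      X⊆M u∈M w∈M u≢w with x∈p∪q⁻ X Y (proj₁ M-module u∈M) | x∈p∪q⁻ X Y (proj₁ M-module w∈M)
      ... | inj₁ u∈X | inj₁ w∈X =
        indecomposable-⊆-module σ (isPrime⇒indecomposable σ X-prime) (p⊆p∪q Y) M-module
          u∈X w∈X u∈M w∈M u≢w
      ... | inj₁ u∈X | inj₂ w∈Y = X⊆M-via-X∩M u∈X u∈M w∈Y w∈M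
      ... | inj₂ u∈Y | inj₁ w∈X = X⊆M-via-X∩M w∈X w∈M u∈Y u∈M
      ... | inj₂ u∈Y | inj₂ w∈Y with adjacent-or-distinguished u∈Y w∈Y u≢w
      ...   | inj₁ uw = X⊆M-via-edge u∈Y w∈Y uw ∈-∪⁅,⁆₁ ∈-∪⁅,⁆₂ u∈M w∈M u≢w
      ...   | inj₂ (z , z∈Y , inj₁ z-u-w) = X⊆M-distinguished u∈Y w∈Y z∈Y u∈M w∈M u≢w z-u-w
      ...   | inj₂ (z , z∈Y , inj₂ z-w-u) = X⊆M-distinguished w∈Y u∈Y z∈Y w∈M u∈M (u≢w ∘ sym) z-w-u

      W⊆M : u ∈ M → w ∈ M → u ≢ w → W ⊆ M
      W⊆M u∈M w∈M u≢w v∈W with x∈p∪q⁻ X Y v∈W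
      ... | inj₁ v∈X = X⊆M u∈M w∈M u≢w v∈X
      ... | inj₂ v∈Y =
        let (z , z∈Y , vz) = no-isolated v∈Y
            (x , y , x∈X , y∈X , x≢y) = pair-of-2≤∣p∣ (≤-trans (n≤1+n 2) (proj₁ X-prime))
            X⊆M′ = X⊆M u∈M w∈M u≢w
        in edge-⊆-module v∈Y z∈Y vz (∈-∪⁅,⁆ˡ x∈X) (∈-∪⁅,⁆ˡ y∈X) (X⊆M′ x∈X) (X⊆M′ y∈X) x≢y ∈-∪⁅,⁆₁

    isPrime-∪ : IsPrime σ (X ∪ Y)
    isPrime-∪ = indecomposable⇒isPrime σ (≤-trans (proj₁ X-prime) (∣p∣≤∣p∪q∣ X Y)) λ M-module → W⊆M M-module

P5Adj? : ∀ i j → Dec (P5Adj i j)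
P5Adj? i j = (toℕ i ℕ.+ 1 ℕ.≟ toℕ j) ⊎-dec (toℕ j ℕ.+ 1 ℕ.≟ toℕ i)

P5-neighbour : ∀ i → ∃[ j ] P5Adj i j
P5-neighbour = from-yes (all? λ i → any? (P5Adj? i))

P5-adjacent-or-distinguished : ∀ i k →
  i ≡ k ⊎ P5Adj i k ⊎ ∃[ j ] (P5Adj i j × ¬ P5Adj k j ⊎ P5Adj k j × ¬ P5Adj i j)
P5-adjacent-or-distinguished = from-yes (all? λ i → all? λ k →
  (i ≟ k) ⊎-dec P5Adj? i k ⊎-dec
  any? λ j → (P5Adj? i j ×-dec ¬? (P5Adj? k j)) ⊎-dec (P5Adj? k j ×-dec ¬? (P5Adj? i j)))

module _ (σ : TwoStructure n) (X : Subset n) {f : Fin 5 → Fin n}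
         (f-induced : ∀ i j → OutsideEdge σ X (f i) (f j) ⇔ P5Adj i j) where

  private
    edge : ∀ {i j} → P5Adj i j → OutsideEdge σ X (f i) (f j)
    edge = Equivalence.from (f-induced _ _)

    non-edge : ∀ {i j} → ¬ P5Adj i j → ¬ OutsideEdge σ X (f i) (f j)
    non-edge ¬ij = ¬ij ∘ Equivalence.to (f-induced _ _)

  induced-P5⊆∁ : image f ⊆ ∁ X
  induced-P5⊆∁ v∈ with ∈-image⁻ f v∈
  ... | i , refl = x∉p⇒x∈∁p (proj₁ (edge (proj₂ (P5-neighbour i))))

  induced-P5-no-isolated : NoIsolatedVertex σ X (image f)
  induced-P5-no-isolated u∈ with ∈-image⁻ f u∈
  ... | i , refl = let (j , ij) = P5-neighbour i in f j , ∈-image⁺ f j , edge ij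

  induced-P5-adjacent-or-distinguished : AdjacentOrDistinguished σ X (image f)
  induced-P5-adjacent-or-distinguished u∈ w∈ u≢w with ∈-image⁻ f u∈ | ∈-image⁻ f w∈
  ... | i , refl | k , refl with P5-adjacent-or-distinguished i k
  ...   | inj₁ refl = contradiction refl u≢w
  ...   | inj₂ (inj₁ ik) = inj₁ (edge ik)
  ...   | inj₂ (inj₂ (j , inj₁ (ij , ¬kj))) = inj₂ (f j , ∈-image⁺ f j , inj₁ (edge ij , non-edge ¬kj))
  ...   | inj₂ (inj₂ (j , inj₂ (kj , ¬ij))) = inj₂ (f j , ∈-image⁺ f j , inj₂ (edge kj , non-edge ¬ij))

lemma4p4 : (n : ℕ) (σ : TwoStructure n) (X : Subset n) →
    X ⊂ ⊤ → IsPrime σ X → S5 σ X →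
    (c : Fin n) → c ∉ X → ¬ ComponentHasInducedP5 σ X c
lemma4p4 n σ X _ X-prime s5 _ _ (f , f-injective , _ , f-induced) =
  s5 (image f , induced-P5⊆∁ σ X f-induced , ∣image∣≡ f-injective ,
      isPrime-∪ σ X X-prime (induced-P5⊆∁ σ X f-induced)
        (induced-P5-no-isolated σ X f-induced) (induced-P5-adjacent-or-distinguished σ X f-induced))
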